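{- Let $b$ be a positive integer and $\lambda=(\lambda_1,\dots,\lambda_k)$ a nonempty $b$-regular partition with $k$ nonzero parts. If $b$ divides $\phi(\lambda)=|\lambda|-|\lambda^{\mathrm I}|$, then $$j_1:=|\lambda|-|\lambda^{\mathrm J}|\le\lambda_1-1.$$
   Context: Young diagram conventions: box $(i,j)$ with row $i$, column $1\le j\le\lambda_i$; the rim of $\lambda$ is the set of boxes $(i,j)\in\lambda$ with $(i+1,j+1)\notin\lambda$. A partition is $b$-regular if no $b$ nonzero parts are equal. The $b$-rim of a $b$-regular $\lambda$: take the first $b$ rim boxes starting from the rightmost box of the first row and moving southwestwards along the rim; if the last box of this piece lies in row $i_0$, start the next piece of $b$ rim boxes at the rightmost box of row $i_0+1$, moving southwestwards; continue until a piece ends in the last row (every piece except possibly the last has $b$ boxes). $\lambda^{\mathrm I}$ is $\lambda$ with its $b$-rim removed, written as $(\mu_1,\dots,\mu_k)$ with some trailing $\mu_i$ possibly $0$. Then $\lambda^{\mathrm J}:=(\mu_1+1,\dots,\mu_{k-1}+1,\mu_k+\delta)$ where $\delta=1$ if $b\mid\phi(\lambda)$ and $\delta=0$ otherwise. -}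

module Defs where

open import Data.Nat using (ℕ; zero; suc; _+_; _∸_; _≤_; _<_; _≥_; _≤ᵇ_; _≟_)
open import Data.Nat.Divisibility using (_∣?_)
open import Data.List using (List; []; _∷_; length; filter)
open import Data.Nat.ListAction using (sum)
open import Data.List.Relation.Unary.All using (All)
open import Data.List.Relation.Unary.Linked using (Linked)
open import Data.Product using (_×_)
open import Relation.Nullary.Decidable using (does; yes; no)
open import Data.Bool using (if_then_else_)

IsPartition : List ℕ → Set
IsPartition l = All (λ v → 0 < v) l × Linked _≥_ l

size : List ℕ → ℕ
size = sum

mult : ℕ → List ℕ → ℕ
mult v l = length (filter (v ≟_) l)

IsRegular : ℕ → List ℕ → Set
IsRegular b l = ∀ v → 0 < v → mult v l < b

-- Removal of the b-rim.  `go b n rows` processes the rows (λ_t, λ_{t+1}, …)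
-- where the current piece starts/continues at the rightmost box of row t
-- with n boxes still to take.  In a non-last row t the rim boxes are the
-- columns λ_{t+1}, …, λ_t (c = λ_t - λ_{t+1} + 1 boxes); in the last row
-- they are all λ_k boxes.  If the piece ends in row t (n ≤ c) the row loses
-- n boxes and the next piece starts at row t+1 with b boxes; otherwise the
-- row loses its c rim boxes and the piece continues in row t+1 (at its
-- rightmost box) with n - c boxes.  A piece reaching the last row ends there.
go : ℕ → ℕ → List ℕ → List ℕ
go b n [] = []
go b n (x ∷ []) = (x ∸ n) ∷ []
go b n (x ∷ y ∷ rest) =
  if n ≤ᵇ (x ∸ y + 1)
  then (x ∸ n) ∷ go b b (y ∷ rest)
  else (x ∸ (x ∸ y + 1)) ∷ go b (n ∸ (x ∸ y + 1)) (y ∷ rest)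

-- λ^I = (μ₁, …, μ_k): λ with its b-rim removed (same length k, trailing
-- entries possibly 0)
lamI : ℕ → List ℕ → List ℕ
lamI b l = go b b l

phi : ℕ → List ℕ → ℕ
phi b l = size l ∸ size (lamI b l)

addJ : ℕ → List ℕ → List ℕ
addJ δ [] = []
addJ δ (x ∷ []) = (x + δ) ∷ []
addJ δ (x ∷ y ∷ rest) = suc x ∷ addJ δ (y ∷ rest)

delta : ℕ → List ℕ → ℕ
delta b l = if does (b ∣? phi b l) then 1 else 0

lamJ : ℕ → List ℕ → List ℕ
lamJ b l = addJ (delta b l) (lamI b l)

-- In every row t < k the b-rim removes at most λ_t − λ_{t+1} + 1 boxes and in the
-- last row at most λ_k, so by telescoping φ(λ) ≤ λ₁ + (k − 1).  Passing from λ^I to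
-- λ^J adds k − 1 + δ boxes back, hence j₁ = φ(λ) − (k − 1) − δ ≤ λ₁ − δ, and δ = 1
-- when b ∣ φ(λ).
module Submission where

open import Defs
open import Data.Nat using (ℕ; _≤_)
open import Data.Nat.Divisibility using (_∣_)
open import Data.List using (List; _∷_)
open import Data.Integer using (+_; _-_) renaming (_≤_ to _≤ℤ_)

open import Data.Nat using (suc; _+_; _∸_; _≤ᵇ_; _≥_; s≤s)
open import Data.Nat.Properties
open import Data.Nat.Divisibility using (_∣?_)
open import Data.Nat.Tactic.RingSolver using (solve-∀)
open import Data.List using ([]; length)
open import Data.List.Relation.Unary.Linked using (Linked; _∷_)
open import Data.Product using (_×_; _,_; ∃₂)
open import Data.Bool using (true; false; T)
open import Relation.Nullary.Decidable using (dec-true)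
open import Relation.Binary.PropositionalEquality
  using (_≡_; refl; sym; trans; cong; subst; subst₂; module ≡-Reasoning)
import Data.Integer as ℤ
import Data.Integer.Properties as ℤ

+m-+n≤+p-+q : ∀ m n p q → m + q ≤ p + n → (+ m) - (+ n) ≤ℤ (+ p) - (+ q)
+m-+n≤+p-+q m n p q m+q≤p+n = begin
  (+ m) - (+ n)        ≡⟨ ℤ.m-n≡m⊖n m n ⟩
  m ℤ.⊖ n              ≡⟨ ℤ.+-cancelˡ-⊖ q m n ⟨
  (q + m) ℤ.⊖ (q + n)  ≤⟨ ℤ.⊖-monoˡ-≤ (q + n) q+m≤n+p ⟩
  (n + p) ℤ.⊖ (q + n)  ≡⟨ cong ((n + p) ℤ.⊖_) (+-comm q n) ⟩
  (n + p) ℤ.⊖ (n + q)  ≡⟨ ℤ.+-cancelˡ-⊖ n p q ⟩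
  p ℤ.⊖ q              ≡⟨ ℤ.m-n≡m⊖n p q ⟨
  (+ p) - (+ q)        ∎
  where
  open ℤ.≤-Reasoning
  q+m≤n+p : q + m ≤ n + p
  q+m≤n+p = subst₂ _≤_ (+-comm m q) (+-comm p n) m+q≤p+n

row-remainder : ∀ {x y m} → y ≤ x → m ≤ x ∸ y + 1 → y ≤ suc (x ∸ m)
row-remainder {x} {y} {m} y≤x m≤ = begin
  y                         ≤⟨ m≤n+m∸n y 1 ⟩
  suc (y ∸ 1)               ≡⟨ cong (λ t → suc (t ∸ 1)) (m∸[m∸n]≡n y≤x) ⟨
  suc (x ∸ (x ∸ y) ∸ 1)     ≡⟨ cong suc (∸-+-assoc x (x ∸ y) 1) ⟩
  suc (x ∸ (x ∸ y + 1))     ≤⟨ s≤s (∸-monoʳ-≤ x m≤) ⟩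
  suc (x ∸ m)               ∎
  where open ≤-Reasoning

go-cons-cons : ∀ b n x y rest → ∃₂ λ m n′ →
  m ≤ x ∸ y + 1 × go b n (x ∷ y ∷ rest) ≡ (x ∸ m) ∷ go b n′ (y ∷ rest)
go-cons-cons b n x y rest with n ≤ᵇ (x ∸ y + 1) in n≤ᵇc
... | true  = n , b , ≤ᵇ⇒≤ n _ (subst T (sym n≤ᵇc) _) , refl
... | false = x ∸ y + 1 , n ∸ (x ∸ y + 1) , ≤-refl , refl

go-cons : ∀ b n x xs → ∃₂ λ z zs → go b n (x ∷ xs) ≡ z ∷ zs
go-cons b n x []         = x ∸ n , [] , refl
go-cons b n x (y ∷ rest) with go-cons-cons b n x y rest
... | m , n′ , _ , eq = x ∸ m , go b n′ (y ∷ rest) , eq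

length-go : ∀ b n l → length (go b n l) ≡ length l
length-go b n []             = refl
length-go b n (x ∷ [])       = refl
length-go b n (x ∷ y ∷ rest) =
  let _ , n′ , _ , eq = go-cons-cons b n x y rest
  in trans (cong length eq) (cong suc (length-go b n′ (y ∷ rest)))

size≤size-go+head+length : ∀ b n x xs → Linked _≥_ (x ∷ xs) →
  size (x ∷ xs) ≤ size (go b n (x ∷ xs)) + x + length xs
size≤size-go+head+length b n x [] _ = begin
  x + 0               ≤⟨ m≤n+m (x + 0) (x ∸ n) ⟩
  x ∸ n + (x + 0)     ≡⟨ rearrange (x ∸ n) x ⟩
  x ∸ n + 0 + x + 0   ∎
  where
  open ≤-Reasoning
  rearrange : ∀ r x → r + (x + 0) ≡ r + 0 + x + 0
  rearrange = solve-∀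
size≤size-go+head+length b n x (y ∷ rest) (y≤x ∷ decreasing)
  with go-cons-cons b n x y rest
... | m , n′ , m≤ , eq rewrite eq = begin
  x + size (y ∷ rest)                          ≤⟨ +-monoʳ-≤ x (size≤size-go+head+length b n′ y rest decreasing) ⟩
  x + (G + y + length rest)                    ≤⟨ +-monoʳ-≤ x (+-monoˡ-≤ (length rest) (+-monoʳ-≤ G (row-remainder y≤x m≤))) ⟩
  x + (G + suc (x ∸ m) + length rest)          ≡⟨ rearrange x G (x ∸ m) (length rest) ⟩
  x ∸ m + G + x + suc (length rest)            ∎
  where
  open ≤-Reasoning
  G = size (go b n′ (y ∷ rest))
  rearrange : ∀ x G r l → x + (G + suc r + l) ≡ r + G + x + suc l
  rearrange = solve-∀

size-addJ : ∀ d z zs → size (addJ d (z ∷ zs)) ≡ size (z ∷ zs) + length zs + d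
size-addJ d z []         = rearrange z d
  where
  rearrange : ∀ z d → z + d + 0 ≡ z + 0 + 0 + d
  rearrange = solve-∀
size-addJ d z (y ∷ rest) = begin
  suc z + size (addJ d (y ∷ rest))             ≡⟨ cong (λ t → suc z + t) (size-addJ d y rest) ⟩
  suc z + (size (y ∷ rest) + length rest + d)  ≡⟨ rearrange z (size (y ∷ rest)) (length rest) d ⟩
  z + size (y ∷ rest) + suc (length rest) + d  ∎
  where
  open ≡-Reasoning
  rearrange : ∀ z s l d → suc z + (s + l + d) ≡ z + s + suc l + d
  rearrange = solve-∀

size-addJ-go : ∀ d b n x xs →
  size (addJ d (go b n (x ∷ xs))) ≡ size (go b n (x ∷ xs)) + length xs + d
size-addJ-go d b n x xs with go-cons b n x xs | length-go b n (x ∷ xs)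
... | z , zs , eq | length≡ rewrite eq =
  trans (size-addJ d z zs) (cong (λ l → size (z ∷ zs) + l + d) (suc-injective length≡))

delta≡1 : ∀ {b l} → b ∣ phi b l → delta b l ≡ 1
delta≡1 {b} {l} b∣φ rewrite dec-true (b ∣? phi b l) b∣φ = refl

lemma5p1 : (b : ℕ) → 1 ≤ b → (x : ℕ) (xs : List ℕ) →
    IsPartition (x ∷ xs) → IsRegular b (x ∷ xs) →
    b ∣ phi b (x ∷ xs) →
    ((+ size (x ∷ xs)) - (+ size (lamJ b (x ∷ xs)))) ≤ℤ ((+ x) - (+ 1))
lemma5p1 b _ x xs (_ , decreasing) _ b∣φ =
  +m-+n≤+p-+q (size (x ∷ xs)) (size (lamJ b (x ∷ xs))) x 1 (begin
  size (x ∷ xs) + 1                      ≤⟨ +-monoˡ-≤ 1 (size≤size-go+head+length b b x xs decreasing) ⟩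
  I + x + length xs + 1                  ≡⟨ rearrange I x (length xs) ⟩
  x + (I + length xs + 1)                ≡⟨ cong (λ δ → x + (I + length xs + δ)) (delta≡1 {l = x ∷ xs} b∣φ) ⟨
  x + (I + length xs + delta b (x ∷ xs)) ≡⟨ cong (λ t → x + t) (size-addJ-go (delta b (x ∷ xs)) b b x xs) ⟨
  x + size (lamJ b (x ∷ xs))             ∎)
  where
  open ≤-Reasoning
  I = size (lamI b (x ∷ xs))
  rearrange : ∀ i x l → i + x + l + 1 ≡ x + (i + l + 1)
  rearrange = solve-∀
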